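{- Let $m \geq 3$. Let $G$ be the graph with vertex set $\mathbb{Z}_m\times\mathbb{Z}_8$ whose edges are: all edges $\{(i,x),(i+1,x+2)\}$ for $i\in\mathbb{Z}_m$, $x\in\mathbb{Z}_8$; and, for every $i\in\mathbb{Z}_m$, the edges $\{(i,x),(i,y)\}$ for each pair $\{x,y\}\in I_1\cup I_3$, where $I_1=\{\{0,1\},\{2,3\},\{4,5\},\{6,7\}\}$ and $I_3=\{\{0,4\},\{1,5\},\{2,6\},\{3,7\}\}$. Then $G$ admits a $C_8$-factorization consisting of two $C_8$-factors.
   Context: A $C_k$-factor of a graph is a spanning subgraph each of whose components is a cycle of length $k$; a $C_k$-factorization is a partition of the edge set into $C_k$-factors. -}

module Defs where

open import Data.Nat using (ℕ; zero; suc; _+_; _%_)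
open import Data.Nat.DivMod using (m%n<n)
open import Data.Fin using (Fin; toℕ; fromℕ<)
open import Data.Product using (Σ; _×_; _,_)
open import Data.Sum using (_⊎_)
open import Data.List using (List; []; _∷_)
open import Data.List.Membership.Propositional using (_∈_)
open import Relation.Binary.PropositionalEquality using (_≡_)
open import Relation.Nullary using (¬_)
open import Function.Definitions using (Injective)

addMod : ∀ {n} → Fin n → ℕ → Fin n
addMod {suc n} i k = fromℕ< (m%n<n (toℕ i + k) (suc n))

I₁ : List (ℕ × ℕ)
I₁ = (0 , 1) ∷ (2 , 3) ∷ (4 , 5) ∷ (6 , 7) ∷ []

I₃ : List (ℕ × ℕ)
I₃ = (0 , 4) ∷ (1 , 5) ∷ (2 , 6) ∷ (3 , 7) ∷ []

InI₁∪I₃ : Fin 8 → Fin 8 → Set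
InI₁∪I₃ x y = ((toℕ x , toℕ y) ∈ I₁) ⊎ ((toℕ y , toℕ x) ∈ I₁)
            ⊎ ((toℕ x , toℕ y) ∈ I₃) ⊎ ((toℕ y , toℕ x) ∈ I₃)

V : ℕ → Set
V m = Fin m × Fin 8

Adj : (m : ℕ) → V m → V m → Set
Adj m (i , x) (j , y) =
    (j ≡ addMod i 1 × y ≡ addMod x 2)
  ⊎ (i ≡ addMod j 1 × x ≡ addMod y 2)
  ⊎ (i ≡ j × InI₁∪I₃ x y)

record Cycle {A : Set} (E : A → A → Set) (k : ℕ) : Set where
  field
    vert     : Fin k → A
    distinct : Injective _≡_ _≡_ vert
    adjacent : ∀ t → E (vert t) (vert (addMod t 1))
open Cycle public

EdgeOf : ∀ {A : Set} {E : A → A → Set} {k} → Cycle E k → A → A → Set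
EdgeOf {k = k} C u v = Σ (Fin k) λ t →
    (vert C t ≡ u × vert C (addMod t 1) ≡ v)
  ⊎ (vert C t ≡ v × vert C (addMod t 1) ≡ u)

-- a C_k-factor: a family of pairwise vertex-disjoint k-cycles of the graph
-- covering every vertex (its edge set is the union of the cycles' edges)
record CkFactor {A : Set} (E : A → A → Set) (k : ℕ) : Set where
  field
    r        : ℕ
    cyc      : Fin r → Cycle E k
    covers   : ∀ v → Σ (Fin r) λ j → Σ (Fin k) λ t → vert (cyc j) t ≡ v
    disjoint : ∀ j j' t t' → vert (cyc j) t ≡ vert (cyc j') t' → j ≡ j'
open CkFactor public

InFactor : ∀ {A : Set} {E : A → A → Set} {k} → CkFactor E k → A → A → Set
InFactor F u v = Σ (Fin (r F)) λ j → EdgeOf (cyc F j) u v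

-- a C_k-factorization consisting of two C_k-factors: two C_k-factors
-- whose edge sets partition the edge set of the graph
-- (every edge of a factor is an edge of the graph by Cycle.adjacent)
TwoCkFactorization : ∀ {A : Set} (E : A → A → Set) (k : ℕ) → Set
TwoCkFactorization E k = Σ (CkFactor E k) λ F₁ → Σ (CkFactor E k) λ F₂ →
  ∀ u v → E u v →
      (InFactor F₁ u v × ¬ InFactor F₂ u v)
    ⊎ (InFactor F₂ u v × ¬ InFactor F₁ u v)

-- Every 8-cycle used lives in two consecutive columns j, j + 1 of ℤ_m × ℤ₈ and is the
-- lift of a closed walk of length 8 in a two-layer quotient of G (layer = column j or
-- j + 1) whose ℤ₈-labels run through ℤ₈ exactly once; hence its m translates are disjoint
-- and cover all vertices, i.e. form a C₈-factor. Two such walks whose projections to ℤ₈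
-- are edge-disjoint and which together traverse every step of the quotient give the two
-- factors: an edge of G lies in the lift of one walk, and its ℤ₈-projection, which is an
-- edge of that walk's projection, cannot be an edge of the other's.
module Submission where

open import Defs
open import Data.Bool using (Bool; true; false; _∨_)
open import Data.Bool.Properties using (∨-comm)
open import Data.Fin using (Fin; toℕ)
open import Data.Fin.Patterns using (0F; 1F; 2F; 3F; 4F; 5F; 6F; 7F)
open import Data.Fin.Properties using (toℕ-injective; toℕ-fromℕ<; toℕ<n; _≟_)
open import Data.List.Membership.Propositional using (_∈_)
open import Data.List.Relation.Unary.Any using (here; there)
open import Data.Nat using (ℕ; suc; _+_; _%_; _≤_; NonZero)
open import Data.Nat.DivMod using (m%n<n; %-distribˡ-+; m%n%n≡m%n; [m+n]%n≡m%n; m<n⇒m%n≡m)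
open import Data.Nat.Properties using (+-assoc; +-comm)
open import Data.Product using (_×_; _,_; proj₁; proj₂)
open import Data.Sum using (_⊎_; inj₁; inj₂)
open import Relation.Nullary using (¬_; does)
open import Relation.Nullary.Decidable using (dec-true)
open import Relation.Binary.PropositionalEquality
  using (_≡_; refl; sym; trans; cong; cong₂; module ≡-Reasoning)

[m%n+k]%n≡[m+k]%n : ∀ m k n .{{_ : NonZero n}} → (m % n + k) % n ≡ (m + k) % n
[m%n+k]%n≡[m+k]%n m k n = begin
  (m % n + k) % n          ≡⟨ %-distribˡ-+ (m % n) k n ⟩
  (m % n % n + k % n) % n  ≡⟨ cong (λ x → (x + k % n) % n) (m%n%n≡m%n m n) ⟩
  (m % n + k % n) % n      ≡⟨ %-distribˡ-+ m k n ⟨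
  (m + k) % n              ∎
  where open ≡-Reasoning

module _ {n : ℕ} where

  toℕ-addMod : ∀ (i : Fin (suc n)) k → toℕ (addMod i k) ≡ (toℕ i + k) % suc n
  toℕ-addMod i k = toℕ-fromℕ< (m%n<n (toℕ i + k) (suc n))

  addMod-addMod : ∀ (i : Fin (suc n)) a b → addMod (addMod i a) b ≡ addMod i (a + b)
  addMod-addMod i a b = toℕ-injective (begin
    toℕ (addMod (addMod i a) b)        ≡⟨ toℕ-addMod (addMod i a) b ⟩
    (toℕ (addMod i a) + b) % suc n     ≡⟨ cong (λ x → (x + b) % suc n) (toℕ-addMod i a) ⟩
    ((toℕ i + a) % suc n + b) % suc n  ≡⟨ [m%n+k]%n≡[m+k]%n (toℕ i + a) b (suc n) ⟩
    (toℕ i + a + b) % suc n            ≡⟨ cong (_% suc n) (+-assoc (toℕ i) a b) ⟩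
    (toℕ i + (a + b)) % suc n          ≡⟨ toℕ-addMod i (a + b) ⟨
    toℕ (addMod i (a + b))             ∎)
    where open ≡-Reasoning

  addMod-period : ∀ (i : Fin (suc n)) → addMod i (suc n) ≡ i
  addMod-period i = toℕ-injective (begin
    toℕ (addMod i (suc n))    ≡⟨ toℕ-addMod i (suc n) ⟩
    (toℕ i + suc n) % suc n   ≡⟨ [m+n]%n≡m%n (toℕ i) (suc n) ⟩
    toℕ i % suc n             ≡⟨ m<n⇒m%n≡m (toℕ<n i) ⟩
    toℕ i                     ∎)
    where open ≡-Reasoning

  column : Bool → Fin (suc n) → Fin (suc n)
  column false j = j
  column true  j = addMod j 1

  uncolumn : Bool → Fin (suc n) → Fin (suc n)
  uncolumn false i = i
  uncolumn true  i = addMod i n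

  column-uncolumn : ∀ b i → column b (uncolumn b i) ≡ i
  column-uncolumn false i = refl
  column-uncolumn true  i = begin
    addMod (addMod i n) 1  ≡⟨ addMod-addMod i n 1 ⟩
    addMod i (n + 1)       ≡⟨ cong (addMod i) (+-comm n 1) ⟩
    addMod i (suc n)       ≡⟨ addMod-period i ⟩
    i                      ∎
    where open ≡-Reasoning

  uncolumn-column : ∀ b j → uncolumn b (column b j) ≡ j
  uncolumn-column false j = refl
  uncolumn-column true  j = trans (addMod-addMod j 1 n) (addMod-period j)

  column-injective : ∀ b {j j′} → column b j ≡ column b j′ → j ≡ j′
  column-injective b {j} {j′} e =
    trans (sym (uncolumn-column b j)) (trans (cong (uncolumn b) e) (uncolumn-column b j′))

-- The two-layer quotient of G: a vertex (b , x) stands for (column b j , x).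
data Step : Bool × Fin 8 → Bool × Fin 8 → Set where
  rise : ∀ x → Step (false , x) (true , addMod x 2)
  fall : ∀ x → Step (true , addMod x 2) (false , x)
  flat : ∀ b {x y} → InI₁∪I₃ x y → Step (b , x) (b , y)

Step⇒Adj : ∀ {n} j {b b′ x y} → Step (b , x) (b′ , y) → Adj (suc n) (column b j , x) (column b′ j , y)
Step⇒Adj j (rise x)   = inj₁ (refl , refl)
Step⇒Adj j (fall x)   = inj₂ (inj₁ (refl , refl))
Step⇒Adj j (flat b p) = inj₂ (inj₂ (refl , p))

record Template : Set where
  field
    level          : Fin 8 → Bool
    label          : Fin 8 → Fin 8
    position       : Fin 8 → Fin 8
    position-label : ∀ t → position (label t) ≡ t
    label-position : ∀ x → label (position x) ≡ x
    step           : ∀ t → Step (level t , label t) (level (addMod t 1) , label (addMod t 1))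

  label-injective : ∀ {t t′} → label t ≡ label t′ → t ≡ t′
  label-injective {t} {t′} e =
    trans (sym (position-label t)) (trans (cong position e) (position-label t′))

  joins : Fin 8 → Fin 8 → Bool
  joins x y = does (label (addMod (position x) 1) ≟ y) ∨ does (label (addMod (position y) 1) ≟ x)

  joins-sym : ∀ x y → joins x y ≡ joins y x
  joins-sym x y = ∨-comm (does (label (addMod (position x) 1) ≟ y)) _

  joins-consecutive : ∀ t → joins (label t) (label (addMod t 1)) ≡ true
  joins-consecutive t =
    cong (_∨ does (label (addMod (position (label (addMod t 1))) 1) ≟ label t))
         (dec-true (_ ≟ _) (cong (λ s → label (addMod s 1)) (position-label t)))

open Template public

module _ {n : ℕ} (T : Template) where

  place : Fin (suc n) → Fin 8 → V (suc n)
  place j t = column (level T t) j , label T t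

  liftCycle : Fin (suc n) → Cycle (Adj (suc n)) 8
  liftCycle j = record
    { vert     = place j
    ; distinct = λ e → label-injective T (cong proj₂ e)
    ; adjacent = λ t → Step⇒Adj j (step T t)
    }

  liftFactor : CkFactor (Adj (suc n)) 8
  liftFactor = record
    { r        = suc n
    ; cyc      = liftCycle
    ; covers   = λ (i , x) → let b = level T (position T x) in
        uncolumn b i , position T x , cong₂ _,_ (column-uncolumn b i) (label-position T x)
    ; disjoint = disjoint′
    }
    where
    disjoint′ : ∀ j j′ t t′ → place j t ≡ place j′ t′ → j ≡ j′
    disjoint′ j j′ t t′ e with label-injective T (cong proj₂ e)
    ... | refl = column-injective (level T t) (cong proj₁ e)

  inLift : ∀ j t → InFactor liftFactor (place j t) (place j (addMod t 1))
  inLift j t = j , t , inj₁ (refl , refl)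

  inLift-flat : ∀ i t → level T t ≡ level T (addMod t 1) →
                InFactor liftFactor (i , label T t) (i , label T (addMod t 1))
  inLift-flat i t same =
    uncolumn (level T t) i , t , inj₁ (placed t refl , placed (addMod t 1) (sym same))
    where
    placed : ∀ {b} s → level T s ≡ b → place (uncolumn b i) s ≡ (i , label T s)
    placed {b} s refl = cong (_, label T s) (column-uncolumn b i)

  liftEdge-label : (P : Fin 8 → Fin 8 → Bool) {c : Bool} → (∀ x y → P x y ≡ P y x) →
                   (∀ t → P (label T t) (label T (addMod t 1)) ≡ c) →
                   ∀ {u v} → InFactor liftFactor u v → P (proj₂ u) (proj₂ v) ≡ c
  liftEdge-label P P-sym consecutive (j , t , inj₁ (refl , refl)) = consecutive t
  liftEdge-label P P-sym consecutive (j , t , inj₂ (refl , refl)) =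
    trans (P-sym _ _) (consecutive t)

InFactor-sym : ∀ {A : Set} {E : A → A → Set} {k} (F : CkFactor E k) {u v} →
               InFactor F u v → InFactor F v u
InFactor-sym F (j , t , inj₁ e) = j , t , inj₂ e
InFactor-sym F (j , t , inj₂ e) = j , t , inj₁ e

liftFactorization : ∀ {n} (T₁ T₂ : Template) →
  (∀ t → joins T₁ (label T₂ t) (label T₂ (addMod t 1)) ≡ false) →
  (∀ u v → Adj (suc n) u v → InFactor (liftFactor T₁) u v ⊎ InFactor (liftFactor T₂) u v) →
  TwoCkFactorization (Adj (suc n)) 8
liftFactorization {n} T₁ T₂ avoids covered =
  liftFactor T₁ , liftFactor T₂ , λ u v e → exclusive (covered u v e)
  where
  notBoth : ∀ {u v} → InFactor (liftFactor {n} T₁) u v → ¬ InFactor (liftFactor T₂) u v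
  notBoth e₁ e₂
    with trans (sym (liftEdge-label T₁ (joins T₁) (joins-sym T₁) (joins-consecutive T₁) e₁))
               (liftEdge-label T₂ (joins T₁) (joins-sym T₁) avoids e₂)
  ... | ()

  exclusive : ∀ {u v} → InFactor (liftFactor T₁) u v ⊎ InFactor (liftFactor T₂) u v →
              (InFactor (liftFactor T₁) u v × ¬ InFactor (liftFactor T₂) u v)
            ⊎ (InFactor (liftFactor T₂) u v × ¬ InFactor (liftFactor T₁) u v)
  exclusive (inj₁ e₁) = inj₁ (e₁ , notBoth e₁)
  exclusive (inj₂ e₂) = inj₂ (e₂ , λ e₁ → notBoth e₁ e₂)

raised : Fin 8 → Bool
raised 0F = false
raised 1F = false
raised 2F = true
raised 3F = true
raised 4F = false
raised 5F = false
raised 6F = true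
raised 7F = true

-- The label sequences are 0 4 6 7 5 1 3 2 and 2 6 0 1 7 3 5 4:
-- two edge-disjoint Hamiltonian cycles of the quotient of G on ℤ₈.
template₁ : Template
template₁ = record
  { level          = raised
  ; label          = label₁
  ; position       = position₁
  ; position-label = λ { 0F → refl ; 1F → refl ; 2F → refl ; 3F → refl
                       ; 4F → refl ; 5F → refl ; 6F → refl ; 7F → refl }
  ; label-position = λ { 0F → refl ; 1F → refl ; 2F → refl ; 3F → refl
                       ; 4F → refl ; 5F → refl ; 6F → refl ; 7F → refl }
  ; step           = λ { 0F → flat false (inj₂ (inj₂ (inj₁ (here refl))))
                       ; 1F → rise 4F
                       ; 2F → flat true (inj₁ (there (there (there (here refl)))))
                       ; 3F → fall 5F
                       ; 4F → flat false (inj₂ (inj₂ (inj₂ (there (here refl)))))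
                       ; 5F → rise 1F
                       ; 6F → flat true (inj₂ (inj₁ (there (here refl))))
                       ; 7F → fall 0F }
  }
  where
  label₁ position₁ : Fin 8 → Fin 8
  label₁ 0F = 0F
  label₁ 1F = 4F
  label₁ 2F = 6F
  label₁ 3F = 7F
  label₁ 4F = 5F
  label₁ 5F = 1F
  label₁ 6F = 3F
  label₁ 7F = 2F
  position₁ 0F = 0F
  position₁ 4F = 1F
  position₁ 6F = 2F
  position₁ 7F = 3F
  position₁ 5F = 4F
  position₁ 1F = 5F
  position₁ 3F = 6F
  position₁ 2F = 7F

template₂ : Template
template₂ = record
  { level          = raised
  ; label          = label₂
  ; position       = position₂
  ; position-label = λ { 0F → refl ; 1F → refl ; 2F → refl ; 3F → refl
                       ; 4F → refl ; 5F → refl ; 6F → refl ; 7F → refl }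
  ; label-position = λ { 0F → refl ; 1F → refl ; 2F → refl ; 3F → refl
                       ; 4F → refl ; 5F → refl ; 6F → refl ; 7F → refl }
  ; step           = λ { 0F → flat false (inj₂ (inj₂ (inj₁ (there (there (here refl))))))
                       ; 1F → rise 6F
                       ; 2F → flat true (inj₁ (here refl))
                       ; 3F → fall 7F
                       ; 4F → flat false (inj₂ (inj₂ (inj₂ (there (there (there (here refl)))))))
                       ; 5F → rise 3F
                       ; 6F → flat true (inj₂ (inj₁ (there (there (here refl)))))
                       ; 7F → fall 2F }
  }
  where
  label₂ position₂ : Fin 8 → Fin 8
  label₂ 0F = 2F
  label₂ 1F = 6F
  label₂ 2F = 0F
  label₂ 3F = 1F
  label₂ 4F = 7F
  label₂ 5F = 3F
  label₂ 6F = 5F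
  label₂ 7F = 4F
  position₂ 2F = 0F
  position₂ 6F = 1F
  position₂ 0F = 2F
  position₂ 1F = 3F
  position₂ 7F = 4F
  position₂ 3F = 5F
  position₂ 5F = 6F
  position₂ 4F = 7F

template₂-avoids-template₁ : ∀ t → joins template₁ (label template₂ t) (label template₂ (addMod t 1)) ≡ false
template₂-avoids-template₁ 0F = refl
template₂-avoids-template₁ 1F = refl
template₂-avoids-template₁ 2F = refl
template₂-avoids-template₁ 3F = refl
template₂-avoids-template₁ 4F = refl
template₂-avoids-template₁ 5F = refl
template₂-avoids-template₁ 6F = refl
template₂-avoids-template₁ 7F = refl

toℕ-pair-injective : ∀ {x y a b : Fin 8} → (toℕ x , toℕ y) ≡ (toℕ a , toℕ b) → x ≡ a × y ≡ b
toℕ-pair-injective p = toℕ-injective (cong proj₁ p) , toℕ-injective (cong proj₂ p)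

module _ {n : ℕ} where

  Covered : V (suc n) → V (suc n) → Set
  Covered u v = InFactor (liftFactor template₁) u v ⊎ InFactor (liftFactor template₂) u v

  Covered-sym : ∀ {u v} → Covered u v → Covered v u
  Covered-sym (inj₁ e) = inj₁ (InFactor-sym (liftFactor template₁) e)
  Covered-sym (inj₂ e) = inj₂ (InFactor-sym (liftFactor template₂) e)

  rising-covered : ∀ i x → Covered (i , x) (addMod i 1 , addMod x 2)
  rising-covered i 0F = inj₁ (InFactor-sym (liftFactor template₁) (inLift template₁ i 7F))
  rising-covered i 1F = inj₁ (inLift template₁ i 5F)
  rising-covered i 2F = inj₂ (InFactor-sym (liftFactor template₂) (inLift template₂ i 7F))
  rising-covered i 3F = inj₂ (inLift template₂ i 5F)
  rising-covered i 4F = inj₁ (inLift template₁ i 1F)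
  rising-covered i 5F = inj₁ (InFactor-sym (liftFactor template₁) (inLift template₁ i 3F))
  rising-covered i 6F = inj₂ (inLift template₂ i 1F)
  rising-covered i 7F = inj₂ (InFactor-sym (liftFactor template₂) (inLift template₂ i 3F))

  I₁-covered : ∀ i {x y} → (toℕ x , toℕ y) ∈ I₁ → Covered (i , x) (i , y)
  I₁-covered i (here p) with toℕ-pair-injective {a = 0F} {b = 1F} p
  ... | refl , refl = inj₂ (inLift-flat template₂ i 2F refl)
  I₁-covered i (there (here p)) with toℕ-pair-injective {a = 2F} {b = 3F} p
  ... | refl , refl = Covered-sym (inj₁ (inLift-flat template₁ i 6F refl))
  I₁-covered i (there (there (here p))) with toℕ-pair-injective {a = 4F} {b = 5F} p
  ... | refl , refl = Covered-sym (inj₂ (inLift-flat template₂ i 6F refl))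
  I₁-covered i (there (there (there (here p)))) with toℕ-pair-injective {a = 6F} {b = 7F} p
  ... | refl , refl = inj₁ (inLift-flat template₁ i 2F refl)

  I₃-covered : ∀ i {x y} → (toℕ x , toℕ y) ∈ I₃ → Covered (i , x) (i , y)
  I₃-covered i (here p) with toℕ-pair-injective {a = 0F} {b = 4F} p
  ... | refl , refl = inj₁ (inLift-flat template₁ i 0F refl)
  I₃-covered i (there (here p)) with toℕ-pair-injective {a = 1F} {b = 5F} p
  ... | refl , refl = Covered-sym (inj₁ (inLift-flat template₁ i 4F refl))
  I₃-covered i (there (there (here p))) with toℕ-pair-injective {a = 2F} {b = 6F} p
  ... | refl , refl = inj₂ (inLift-flat template₂ i 0F refl)
  I₃-covered i (there (there (there (here p)))) with toℕ-pair-injective {a = 3F} {b = 7F} p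
  ... | refl , refl = Covered-sym (inj₂ (inLift-flat template₂ i 4F refl))

  Adj⇒Covered : ∀ u v → Adj (suc n) u v → Covered u v
  Adj⇒Covered (i , x) _ (inj₁ (refl , refl))        = rising-covered i x
  Adj⇒Covered _ (j , y) (inj₂ (inj₁ (refl , refl))) = Covered-sym (rising-covered j y)
  Adj⇒Covered (i , _) _ (inj₂ (inj₂ (refl , inj₁ p)))                = I₁-covered i p
  Adj⇒Covered (i , _) _ (inj₂ (inj₂ (refl , inj₂ (inj₁ p))))         = Covered-sym (I₁-covered i p)
  Adj⇒Covered (i , _) _ (inj₂ (inj₂ (refl , inj₂ (inj₂ (inj₁ p))))) = I₃-covered i p
  Adj⇒Covered (i , _) _ (inj₂ (inj₂ (refl , inj₂ (inj₂ (inj₂ p))))) = Covered-sym (I₃-covered i p)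

-- The construction works for every m ≥ 1; m ≥ 3 only makes G a simple graph.
lemma2p11 : (m : ℕ) → 3 ≤ m → TwoCkFactorization (Adj m) 8
lemma2p11 (suc n) _ =
  liftFactorization template₁ template₂ template₂-avoids-template₁ Adj⇒Covered
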